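{- The set of all GT-words is closed under taking (non-empty) factors: every non-empty factor of a GT-word is a GT-word.
   Context: Words are finite sequences of letters; $|w|$ is the length and $\mathrm{Alph}(w)$ the set of letters of $w$. A factor is a contiguous subword. $C_w(n)$ is the number of distinct factors of $w$ of length $n$. A word $w$ with $|\mathrm{Alph}(w)|\ge 2$ is a GT-word if there exist positive integers $m\le M$ such that $C_w(0)=1$, $C_w(i)=|\mathrm{Alph}(w)|+i-1$ for $1\le i\le m$, $C_w(i+1)=C_w(i)$ for $m\le i\le M-1$, and $C_w(i+1)=C_w(i)-1$ for $M\le i\le |w|$ (with $C_w(|w|+1)=0$). Every non-empty word with one distinct letter is also a GT-word. -}

module Defs where

open import Data.Nat using (ℕ; zero; suc; _+_; _∸_; _≤_; _≤?_)
open import Data.List using (List; []; _∷_; _++_; length; map; filter; tails; take; deduplicate)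
import Data.List.Properties as LP
open import Data.Product using (Σ; _×_; ∃; ∃-syntax)
open import Data.Sum using (_⊎_)
open import Relation.Binary.PropositionalEquality using (_≡_; _≢_)
open import Relation.Binary.Definitions using (DecidableEquality)

module _ {A : Set} (_≟_ : DecidableEquality A) where

  Alph : List A → List A
  Alph w = deduplicate _≟_ w

  -- all factor occurrences of length n (one per starting position i with i + n ≤ |w|)
  factorOccurrences : ℕ → List A → List (List A)
  factorOccurrences n w = map (take n) (filter (λ s → n ≤? length s) (tails w))

  C : List A → ℕ → ℕ
  C w n = length (deduplicate (LP.≡-dec _≟_) (factorOccurrences n w))

  IsGT : List A → Set
  IsGT w =
      (w ≢ [] × length (Alph w) ≡ 1)
    ⊎ (2 ≤ length (Alph w)
       × Σ ℕ λ m → Σ ℕ λ M →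
           1 ≤ m × m ≤ M
         × C w 0 ≡ 1
         × (∀ i → 1 ≤ i → i ≤ m → C w i ≡ length (Alph w) + i ∸ 1)
         × (∀ i → m ≤ i → i + 1 ≤ M → C w (suc i) ≡ C w i)
         × (∀ i → M ≤ i → i ≤ length w → C w (suc i) + 1 ≡ C w i))

Factor : {A : Set} → List A → List A → Set
Factor {A} u w = Σ (List A) λ p → Σ (List A) λ s → w ≡ p ++ u ++ s

module Submission where

-- Write C w n for the number of distinct factors of length n of w; w grows
-- slowly if C w (n + 1) ≤ C w n + 1 for all n ≥ 1.  GT-words grow slowly, and
--  1. slow growth passes to factors: prepending a letter adds at most one new
--     factor of each length (`growth-tail'), and reversal preserves C;
--  2. in every word C w (n + 1) + 1 = C w n + (number of branching positions)
--     (`counting'), which relates C to right special factors; so a descent of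
--     C by one persists (`descent-persists') and after a plateau C never rises
--     (`plateau-persists', via a first-occurrence argument on left specials);
--  3. any sequence with these local properties has the three-phase GT profile
--     (module `Shape'), so nonempty slowly growing words with two letters are
--     GT-words.
-- The general facts (distinct counts, factors, contexts, positions, `Shape')
-- come first, then complexity in module `Words', and the theorem last.

open import Data.Nat using (ℕ; zero; suc; _+_; _∸_; _≤_; _<_; z≤n; s≤s; _≤?_)
open import Data.Nat.Properties
import Data.Nat as ℕ using (_≟_; _<?_)
open import Data.Maybe.Properties using (just-injective)
import Data.Maybe.Properties as Maybe using (≡-dec)
open import Data.List using (List; []; _∷_; _++_; length; map; filter; deduplicate; take; drop; reverse; [_])
open import Data.List.Properties
  using ( filter-all; filter-notAll; filter-accept; filter-reject; length-map; length-++; ++-assoc; ++-identityʳ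
        ; ++-conicalʳ; take-take; take++drop≡id; ∷-injective; ∷-injectiveˡ; ∷-injectiveʳ; ∷ʳ-injectiveʳ; ≡-dec
        ; reverse-involutive; reverse-injective; length-reverse; reverse-++; unfold-reverse )
open import Data.List.Membership.Propositional using (_∈_; _∉_)
open import Data.List.Membership.Propositional.Properties
  using (∈-deduplicate⁺; ∈-deduplicate⁻; ∈-filter⁺; ∈-map⁺; ∈-map⁻; ∈-∃++; ∈-++⁺ˡ; ∈-++⁺ʳ)
open import Data.List.Relation.Binary.Subset.Propositional using (_⊆_)
open import Data.List.Relation.Unary.Any using (here; there)
import Data.List.Relation.Unary.Any as Any
import Data.List.Relation.Unary.All as All
open import Data.List.Relation.Unary.All.Properties using (¬Any⇒All¬)
open import Data.List.Relation.Unary.AllPairs using ([]; _∷_)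
open import Data.List.Relation.Unary.Unique.Propositional using (Unique)
import Data.List.Relation.Unary.Unique.Propositional.Properties as Unique
open import Data.List.Relation.Unary.Unique.DecPropositional.Properties using (deduplicate-!)
open import Data.Product using (Σ; _×_; _,_; proj₁; proj₂; map₂)
open import Data.Sum using (_⊎_; inj₁; inj₂; [_,_]′)
open import Data.Maybe using (Maybe; just; nothing)
open import Data.Empty using (⊥; ⊥-elim)
open import Function using (_∘_)
open import Relation.Binary.PropositionalEquality hiding ([_])
open import Relation.Binary.Definitions using (DecidableEquality)
open import Relation.Nullary using (¬_; Dec; yes; no; ¬?)

open import Defs hiding (C)
import Defs

module _ {X : Set} (_≟_ : DecidableEquality X) where

  distinct : List X → ℕ
  distinct xs = length (deduplicate _≟_ xs)

  unique-⊆-length : ∀ {D E : List X} → Unique D → D ⊆ E → length D ≤ length E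
  unique-⊆-length {[]} _ _ = z≤n
  unique-⊆-length {x ∷ D} {E} (x∉D ∷ uniqueD) D⊆E =
    ≤-trans (s≤s (unique-⊆-length uniqueD D⊆E∖x))
            (filter-notAll (¬? ∘ (x ≟_)) E (Any.map (λ x≡z x≢z → x≢z x≡z) (D⊆E (here refl))))
    where
      D⊆E∖x : D ⊆ filter (¬? ∘ (x ≟_)) E
      D⊆E∖x z∈D = ∈-filter⁺ (¬? ∘ (x ≟_)) (D⊆E (there z∈D)) (All.lookup x∉D z∈D)

  unique-length-≡ : ∀ {D E : List X} → Unique D → Unique E → D ⊆ E → E ⊆ D → length D ≡ length E
  unique-length-≡ uD uE D⊆E E⊆D = ≤-antisym (unique-⊆-length uD D⊆E) (unique-⊆-length uE E⊆D)

  distinct-mono : ∀ {xs ys : List X} → xs ⊆ ys → distinct xs ≤ distinct ys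
  distinct-mono {xs} xs⊆ys = unique-⊆-length (deduplicate-! _≟_ xs)
    (λ z∈ → ∈-deduplicate⁺ _≟_ (xs⊆ys (∈-deduplicate⁻ _≟_ xs z∈)))

  distinct-cong : ∀ {xs ys : List X} → xs ⊆ ys → ys ⊆ xs → distinct xs ≡ distinct ys
  distinct-cong xs⊆ys ys⊆xs = ≤-antisym (distinct-mono xs⊆ys) (distinct-mono ys⊆xs)

  distinct-∷-∈ : ∀ {x} xs → x ∈ xs → distinct (x ∷ xs) ≡ distinct xs
  distinct-∷-∈ xs x∈xs = distinct-cong (λ { (here refl) → x∈xs ; (there z∈) → z∈ }) there

  distinct-∷-∉ : ∀ {x} xs → x ∉ xs → distinct (x ∷ xs) ≡ suc (distinct xs)
  distinct-∷-∉ {x} xs x∉xs = cong (suc ∘ length)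
    (filter-all (¬? ∘ (x ≟_)) (¬Any⇒All¬ _ (x∉xs ∘ ∈-deduplicate⁻ _≟_ xs)))

distinct-map : ∀ {X Y : Set} (_≟X_ : DecidableEquality X) (_≟Y_ : DecidableEquality Y)
               (f : X → Y) → (∀ {a b} → f a ≡ f b → a ≡ b) →
               ∀ xs → distinct _≟Y_ (map f xs) ≡ distinct _≟X_ xs
distinct-map _≟X_ _≟Y_ f f-inj xs =
  trans (unique-length-≡ _≟Y_ (deduplicate-! _≟Y_ _) (Unique.map⁺ f-inj (deduplicate-! _≟X_ xs))
                         dedup⊆image image⊆dedup)
        (length-map f (deduplicate _≟X_ xs))
  where
    dedup⊆image : deduplicate _≟Y_ (map f xs) ⊆ map f (deduplicate _≟X_ xs)
    dedup⊆image z∈ with a , a∈ , refl ← ∈-map⁻ f (∈-deduplicate⁻ _≟Y_ (map f xs) z∈) =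
      ∈-map⁺ f (∈-deduplicate⁺ _≟X_ a∈)
    image⊆dedup : map f (deduplicate _≟X_ xs) ⊆ deduplicate _≟Y_ (map f xs)
    image⊆dedup z∈ with a , a∈ , refl ← ∈-map⁻ f z∈ =
      ∈-deduplicate⁺ _≟Y_ (∈-map⁺ f (∈-deduplicate⁻ _≟X_ xs a∈))

Prefix : {A : Set} → List A → List A → Set
Prefix {A} u w = Σ (List A) λ s → w ≡ u ++ s

Suffix : {A : Set} → List A → List A → Set
Suffix {A} u w = Σ (List A) λ p → w ≡ p ++ u

module _ {A : Set} where

  prefix⇒factor : ∀ {u w : List A} → Prefix u w → Factor u w
  prefix⇒factor (s , w≡us) = [] , s , w≡us

  suffix⇒factor : ∀ {u w : List A} → Suffix u w → Factor u w
  suffix⇒factor {u} (p , w≡pu) = p , [] , trans w≡pu (cong (p ++_) (sym (++-identityʳ u)))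

  factor-refl : ∀ (w : List A) → Factor w w
  factor-refl w = [] , [] , sym (++-identityʳ w)

  factor-∷ : ∀ {v w : List A} a → Factor v w → Factor v (a ∷ w)
  factor-∷ a (p , s , w≡) = a ∷ p , s , cong (a ∷_) w≡

  factor-∷⁻ : ∀ {v w : List A} {a} → Factor v (a ∷ w) → Factor v w ⊎ Prefix v (a ∷ w)
  factor-∷⁻ ([] , s , w≡) = inj₂ (s , w≡)
  factor-∷⁻ (b ∷ p , s , w≡) with refl , w≡′ ← ∷-injective w≡ = inj₁ (p , s , w≡′)

  suffix-∷⁻ : ∀ {u w : List A} {a} → Suffix u (a ∷ w) → Suffix u w ⊎ u ≡ a ∷ w
  suffix-∷⁻ ([] , w≡) = inj₂ (sym w≡)
  suffix-∷⁻ (b ∷ p , w≡) = inj₁ (p , ∷-injectiveʳ w≡)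

  factor-[] : ∀ {v : List A} → Factor v [] → v ≡ []
  factor-[] {[]} _ = refl
  factor-[] {x ∷ v} ([] , s , ())
  factor-[] {x ∷ v} (_ ∷ _ , s , ())

  factor-length : ∀ {v w : List A} → Factor v w → length v ≤ length w
  factor-length {v} (p , s , refl) = begin
    length v                    ≤⟨ m≤m+n (length v) (length s) ⟩
    length v + length s         ≡⟨ length-++ v ⟨
    length (v ++ s)             ≤⟨ m≤n+m (length (v ++ s)) (length p) ⟩
    length p + length (v ++ s)  ≡⟨ length-++ p ⟨
    length (p ++ v ++ s)        ∎
    where open ≤-Reasoning

  factor-++ˡ : ∀ (u v : List A) {w} → Factor (u ++ v) w → Factor u w
  factor-++ˡ u v (p , s , w≡) = p , v ++ s , trans w≡ (cong (p ++_) (++-assoc u v s))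

  factor-++ʳ : ∀ (u v : List A) {w} → Factor (u ++ v) w → Factor v w
  factor-++ʳ u v (p , s , w≡) = p ++ u , s ,
    trans w≡ (trans (cong (p ++_) (++-assoc u v s)) (sym (++-assoc p u (v ++ s))))

  take-prefix : ∀ n (s : List A) → Prefix (take n s) s
  take-prefix n s = drop n s , sym (take++drop≡id n s)

  prefix-take : ∀ {u s : List A} → Prefix u s → take (length u) s ≡ u
  prefix-take {[]} _ = refl
  prefix-take {x ∷ u} (t , refl) = cong (x ∷_) (prefix-take (t , refl))

  prefix-unique : ∀ {u u′ s : List A} → length u ≡ length u′ → Prefix u s → Prefix u′ s → u ≡ u′
  prefix-unique |u|≡|u′| pre pre′ =
    trans (sym (prefix-take pre)) (trans (cong (λ k → take k _) |u|≡|u′|) (prefix-take pre′))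

  length-take-≤ : ∀ n (s : List A) → n ≤ length s → length (take n s) ≡ n
  length-take-≤ zero s _ = refl
  length-take-≤ (suc n) (x ∷ s) (s≤s n≤) = cong suc (length-take-≤ n s n≤)

  length-snoc : ∀ (u : List A) c → length (u ++ [ c ]) ≡ suc (length u)
  length-snoc u c = trans (length-++ u) (+-comm (length u) 1)

  take-snoc : ∀ n (s : List A) → suc n ≤ length s → Σ A λ e → take (suc n) s ≡ take n s ++ [ e ]
  take-snoc zero (x ∷ s) _ = x , refl
  take-snoc (suc n) (x ∷ s) (s≤s n<) with e , eq ← take-snoc n s n< = e , cong (x ∷_) eq

  factor-reverse : ∀ {u w : List A} → Factor u w → Factor (reverse u) (reverse w)
  factor-reverse {u} (p , s , refl) = reverse s , reverse p ,
    trans (reverse-++ p (u ++ s))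
      (trans (cong (_++ reverse p) (reverse-++ u s)) (++-assoc (reverse s) (reverse u) (reverse p)))

  prefix-reverse : ∀ {u w : List A} → Prefix u w → Suffix (reverse u) (reverse w)
  prefix-reverse {u} (s , refl) = reverse s , reverse-++ u s

  suffix-reverse : ∀ {u w : List A} → Suffix u w → Prefix (reverse u) (reverse w)
  suffix-reverse {u} (p , refl) = reverse p , reverse-++ p u

  suffix-unique : ∀ {u u′ w : List A} → length u ≡ length u′ → Suffix u w → Suffix u′ w → u ≡ u′
  suffix-unique {u} {u′} |u|≡|u′| suf suf′ = reverse-injective (prefix-unique
    (trans (length-reverse u) (trans |u|≡|u′| (sym (length-reverse u′))))
    (suffix-reverse suf) (suffix-reverse suf′))

-- A right context of u in w is a letter c such that u c is a factor
-- of w, or `nothing' when u is a suffix of w (u is followed by the end of w);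
-- left contexts are the mirror image.  A factor with two distinct right
-- contexts is right special.
RightExt : {A : Set} → List A → Maybe A → List A → Set
RightExt u (just c) w = Factor (u ++ [ c ]) w
RightExt u nothing w = Suffix u w

LeftExt : {A : Set} → Maybe A → List A → List A → Set
LeftExt (just c) u w = Factor (c ∷ u) w
LeftExt nothing u w = Prefix u w

ExtAtStart : {A : Set} → List A → Maybe A → List A → Set
ExtAtStart u (just c) s = Prefix (u ++ [ c ]) s
ExtAtStart u nothing s = u ≡ s

RightSpecial : {A : Set} → ℕ → List A → List A → Set
RightSpecial {A} n w u =
  length u ≡ n × Σ (Maybe A) λ m → Σ (Maybe A) λ m′ → m ≢ m′ × RightExt u m w × RightExt u m′ w

LeftSpecial : {A : Set} → ℕ → List A → List A → Set
LeftSpecial {A} n w u =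
  length u ≡ n × Σ (Maybe A) λ m → Σ (Maybe A) λ m′ → m ≢ m′ × LeftExt m u w × LeftExt m′ u w

RightTriple : {A : Set} → ℕ → List A → List A → Set
RightTriple {A} n w u = length u ≡ n × Σ (Maybe A) λ m₁ → Σ (Maybe A) λ m₂ → Σ (Maybe A) λ m₃ →
  RightExt u m₁ w × RightExt u m₂ w × RightExt u m₃ w × m₁ ≢ m₂ × m₁ ≢ m₃ × m₂ ≢ m₃

LeftTriple : {A : Set} → ℕ → List A → List A → Set
LeftTriple {A} n w u = length u ≡ n × Σ (Maybe A) λ m₁ → Σ (Maybe A) λ m₂ → Σ (Maybe A) λ m₃ →
  LeftExt m₁ u w × LeftExt m₂ u w × LeftExt m₃ u w × m₁ ≢ m₂ × m₁ ≢ m₃ × m₂ ≢ m₃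

module _ {A : Set} where

  rightExt-∷ : ∀ {u m} {w : List A} a → RightExt u m w → RightExt u m (a ∷ w)
  rightExt-∷ {m = just c} a ext = factor-∷ a ext
  rightExt-∷ {m = nothing} a (p , w≡) = a ∷ p , cong (a ∷_) w≡

  rightExt-∷⁻ : ∀ {u m a} {w : List A} →
                RightExt u m (a ∷ w) → RightExt u m w ⊎ ExtAtStart u m (a ∷ w)
  rightExt-∷⁻ {m = just c} ext = factor-∷⁻ ext
  rightExt-∷⁻ {m = nothing} ext = suffix-∷⁻ ext

  rightExt⇒factor : ∀ {u m} {w : List A} → RightExt u m w → Factor u w
  rightExt⇒factor {u} {just c} ext = factor-++ˡ u [ c ] ext
  rightExt⇒factor {m = nothing} ext = suffix⇒factor ext

  factor⇒rightExt : ∀ {u w : List A} → Factor u w → Σ (Maybe A) λ m → RightExt u m w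
  factor⇒rightExt (p , [] , w≡) = nothing , p , trans w≡ (cong (p ++_) (++-identityʳ _))
  factor⇒rightExt {u} (p , c ∷ s , w≡) =
    just c , p , s , trans w≡ (cong (p ++_) (sym (++-assoc u [ c ] s)))

  rightExt-tail : ∀ {a u m} {w : List A} → RightExt (a ∷ u) m w → RightExt u m w
  rightExt-tail {a} {u} {just c} ext = factor-++ʳ [ a ] (u ++ [ c ]) ext
  rightExt-tail {a} {u} {nothing} (p , w≡) = p ++ [ a ] , trans w≡ (sym (++-assoc p [ a ] u))

  rightSpecial-tail : ∀ {n a u} {w : List A} → RightSpecial (suc n) w (a ∷ u) → RightSpecial n w u
  rightSpecial-tail (|u|≡ , m , m′ , m≢m′ , ext , ext′) =
    suc-injective |u|≡ , m , m′ , m≢m′ , rightExt-tail ext , rightExt-tail ext′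

  rightTriple-tail : ∀ {n a u} {w : List A} → RightTriple (suc n) w (a ∷ u) → RightTriple n w u
  rightTriple-tail (|u|≡ , m₁ , m₂ , m₃ , ext₁ , ext₂ , ext₃ , ≢s) =
    suc-injective |u|≡ , m₁ , m₂ , m₃ , rightExt-tail ext₁ , rightExt-tail ext₂ , rightExt-tail ext₃ , ≢s

  rightSpecial-∷ : ∀ {n u} {w : List A} a → RightSpecial n w u → RightSpecial n (a ∷ w) u
  rightSpecial-∷ a (|u|≡ , m , m′ , m≢m′ , ext , ext′) =
    |u|≡ , m , m′ , m≢m′ , rightExt-∷ a ext , rightExt-∷ a ext′

  rightTriple-∷ : ∀ {n u} {w : List A} a → RightTriple n w u → RightTriple n (a ∷ w) u
  rightTriple-∷ a (|u|≡ , m₁ , m₂ , m₃ , ext₁ , ext₂ , ext₃ , ≢s) =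
    |u|≡ , m₁ , m₂ , m₃ , rightExt-∷ a ext₁ , rightExt-∷ a ext₂ , rightExt-∷ a ext₃ , ≢s

  extAtStart⇒prefix : ∀ {u m} {s : List A} → ExtAtStart u m s → Prefix u s
  extAtStart⇒prefix {u} {just c} (t , s≡) = c ∷ t , trans s≡ (++-assoc u [ c ] t)
  extAtStart⇒prefix {u} {nothing} refl = [] , sym (++-identityʳ u)

  snoc-not-prefix : ∀ (u : List A) c → ¬ Prefix (u ++ [ c ]) u
  snoc-not-prefix u c pre =
    1+n≰n (subst (_≤ length u) (length-snoc u c) (factor-length (prefix⇒factor pre)))

  extAtStart-unique : ∀ {u u′ m m′} {s : List A} → length u ≡ length u′ →
                      ExtAtStart u m s → ExtAtStart u′ m′ s → u ≡ u′
  extAtStart-unique |u|≡ start start′ =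
    prefix-unique |u|≡ (extAtStart⇒prefix start) (extAtStart⇒prefix start′)

  extAtStart-unique-context : ∀ {u m m′} {s : List A} → ExtAtStart u m s → ExtAtStart u m′ s → m ≡ m′
  extAtStart-unique-context {u} {just c} {just c′} pre pre′ = cong just (∷ʳ-injectiveʳ u u
    (prefix-unique (trans (length-snoc u c) (sym (length-snoc u c′))) pre pre′))
  extAtStart-unique-context {u} {nothing} {nothing} _ _ = refl
  extAtStart-unique-context {u} {just c} {nothing} pre refl = ⊥-elim (snoc-not-prefix u c pre)
  extAtStart-unique-context {u} {nothing} {just c} refl pre = ⊥-elim (snoc-not-prefix u c pre)

  rightExt-[] : ∀ {u m m′} → m ≢ m′ → RightExt {A} u m [] → RightExt u m′ [] → ⊥
  rightExt-[] {u} {just c} _ ext _ with () ← ++-conicalʳ u [ c ] (factor-[] ext)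
  rightExt-[] {u} {nothing} {just c} _ _ ext with () ← ++-conicalʳ u [ c ] (factor-[] ext)
  rightExt-[] {u} {nothing} {nothing} m≢m′ _ _ = m≢m′ refl

  leftExt-reverse : ∀ {m u} {w : List A} → LeftExt m u w → RightExt (reverse u) m (reverse w)
  leftExt-reverse {just c} {u} ext = subst (λ z → Factor z _) (unfold-reverse c u) (factor-reverse ext)
  leftExt-reverse {nothing} pre = prefix-reverse pre

  leftSpecial-reverse : ∀ {n u} {w : List A} → LeftSpecial n w u → RightSpecial n (reverse w) (reverse u)
  leftSpecial-reverse {u = u} (|u|≡ , m , m′ , m≢m′ , ext , ext′) =
    trans (length-reverse u) |u|≡ , m , m′ , m≢m′ , leftExt-reverse ext , leftExt-reverse ext′

  leftTriple-reverse : ∀ {n u} {w : List A} → LeftTriple n w u → RightTriple n (reverse w) (reverse u)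
  leftTriple-reverse {u = u} (|u|≡ , m₁ , m₂ , m₃ , ext₁ , ext₂ , ext₃ , ≢s) =
    trans (length-reverse u) |u|≡ , m₁ , m₂ , m₃ ,
    leftExt-reverse ext₁ , leftExt-reverse ext₂ , leftExt-reverse ext₃ , ≢s

least-witness : (P : ℕ → Set) → (∀ k → Dec (P k)) → ∀ {k} → P k →
                Σ ℕ λ i → P i × (∀ j → j < i → ¬ P j)
least-witness P P? {k} Pk with P? 0
... | yes P0 = 0 , P0 , λ _ ()
least-witness P P? {zero} Pk | no ¬P0 = ⊥-elim (¬P0 Pk)
least-witness P P? {suc k} Pk | no ¬P0 with i , Pi , below ← least-witness (P ∘ suc) (P? ∘ suc) Pk =
  suc i , Pi , λ { zero _ → ¬P0 ; (suc j) j<i → below j (<-pred j<i) }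

below-least : ∀ {P : ℕ → Set} {i k} → (∀ j → j < i → ¬ P j) → P k → i ≤ k
below-least below Pk = ≮⇒≥ (λ k<i → below _ k<i Pk)

module Shape (c : ℕ → ℕ) (N : ℕ) (1≤N : 1 ≤ N)
  (rise≤1 : ∀ n → 1 ≤ n → c (suc n) ≤ suc (c n))
  (fall≤1 : ∀ n → n ≤ N → c n ≤ c (suc n) + 1)
  (descent-persists : ∀ n → suc n ≤ N → c (suc n) + 1 ≡ c n → c (suc (suc n)) + 1 ≡ c (suc n))
  (plateau-persists : ∀ n → suc n ≤ N → c (suc n) ≡ c n → c (suc (suc n)) ≤ c (suc n))
  (falls-at-end : c (suc N) + 1 ≤ c N)
  where

  private
    Flat : ℕ → Set
    Flat k = c (suc (suc k)) ≤ c (suc k)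

    Falls : ℕ → Set
    Falls k = c (suc k) + 1 ≤ c k

    N∸1+1 : suc (N ∸ 1) ≡ N
    N∸1+1 = m+[n∸m]≡n 1≤N

    flat-at-end : Flat (N ∸ 1)
    flat-at-end = subst (λ k → c (suc k) ≤ c k) (sym N∸1+1) (≤-trans (m≤m+n _ 1) falls-at-end)

    not-falling : ∀ {k} → ¬ Falls k → c k ≤ c (suc k)
    not-falling {k} ¬falls = ≤-pred (subst (c k <_) (+-comm (c (suc k)) 1) (≰⇒> ¬falls))

    first-flat : Σ ℕ λ k₀ → Flat k₀ × (∀ j → j < k₀ → ¬ Flat j)
    first-flat = least-witness Flat (λ k → c (suc (suc k)) ≤? c (suc k)) flat-at-end

    k₀ : ℕ
    k₀ = proj₁ first-flat

  m : ℕ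
  m = suc k₀

  private
    m≤N : m ≤ N
    m≤N = subst (m ≤_) N∸1+1 (s≤s (below-least (proj₂ (proj₂ first-flat)) flat-at-end))

    rising : ∀ i → i ≤ k₀ → c (suc i) ≡ c 1 + i
    rising zero _ = sym (+-identityʳ (c 1))
    rising (suc i) i<k₀ = begin
      c (suc (suc i))  ≡⟨ ≤-antisym (rise≤1 (suc i) (s≤s z≤n)) (≰⇒> (proj₂ (proj₂ first-flat) i i<k₀)) ⟩
      suc (c (suc i))  ≡⟨ cong suc (rising i (≤-trans (n≤1+n i) i<k₀)) ⟩
      suc (c 1 + i)    ≡⟨ +-suc (c 1) i ⟨
      c 1 + suc i      ∎
      where open ≡-Reasoning

    falls-at-end′ : Falls (m + (N ∸ m))
    falls-at-end′ = subst Falls (sym (m+[n∸m]≡n m≤N)) falls-at-end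

    first-fall : Σ ℕ λ t₀ → Falls (m + t₀) × (∀ j → j < t₀ → ¬ Falls (m + j))
    first-fall = least-witness (Falls ∘ (m +_)) (λ t → c (suc (m + t)) + 1 ≤? c (m + t))
                               falls-at-end′

    t₀ : ℕ
    t₀ = proj₁ first-fall

  M : ℕ
  M = m + t₀

  m≤M : m ≤ M
  m≤M = m≤m+n m t₀

  private
    M≤N : M ≤ N
    M≤N = subst (M ≤_) (m+[n∸m]≡n m≤N)
                (+-monoʳ-≤ m (below-least (proj₂ (proj₂ first-fall)) falls-at-end′))

    -- from m to M it is level: it cannot rise after a plateau and does not fall before M
    level : ∀ t → t < t₀ → c (suc (m + t)) ≡ c (m + t)
    level t t<t₀ = ≤-antisym (upper t t<t₀) (not-falling (proj₂ (proj₂ first-fall) t t<t₀))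
      where
        upper : ∀ t → t < t₀ → c (suc (m + t)) ≤ c (m + t)
        upper zero _ = subst (λ k → c (suc k) ≤ c k) (sym (+-identityʳ m)) (proj₁ (proj₂ first-flat))
        upper (suc t) t+1<t₀ = subst (λ k → c (suc k) ≤ c k) (sym (+-suc m t))
          (plateau-persists (m + t)
             (≤-trans (subst (_≤ M) (+-suc m t) (+-monoʳ-≤ m (<⇒≤ t+1<t₀))) M≤N)
             (level t (≤-trans (n≤1+n _) t+1<t₀)))

    falling : ∀ s → M + s ≤ N → c (suc (M + s)) + 1 ≡ c (M + s)
    falling zero _ = subst (λ k → c (suc k) + 1 ≡ c k) (sym (+-identityʳ M))
      (≤-antisym (proj₁ (proj₂ first-fall)) (fall≤1 M M≤N))
    falling (suc s) M+s+1≤ = subst (λ k → c (suc k) + 1 ≡ c k) (sym (+-suc M s))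
      (descent-persists (M + s) (subst (_≤ N) (+-suc M s) M+s+1≤)
                        (falling s (≤-trans (n≤1+n _) (subst (_≤ N) (+-suc M s) M+s+1≤))))

  -- the three phases, indexed as in the definition of a GT-word
  phase₁ : ∀ i → 1 ≤ i → i ≤ m → c i ≡ c 1 + i ∸ 1
  phase₁ (suc i) _ (s≤s i≤k₀) = trans (rising i i≤k₀) (cong (_∸ 1) (sym (+-suc (c 1) i)))

  phase₂ : ∀ i → m ≤ i → i + 1 ≤ M → c (suc i) ≡ c i
  phase₂ i m≤i i+1≤M = subst (λ k → c (suc k) ≡ c k) (m+[n∸m]≡n m≤i) (level (i ∸ m) i∸m<t₀)
    where
      open ≤-Reasoning
      i∸m<t₀ : i ∸ m < t₀
      i∸m<t₀ = +-cancelˡ-≤ m _ _ (begin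
        m + suc (i ∸ m)   ≡⟨ +-suc m (i ∸ m) ⟩
        suc (m + (i ∸ m)) ≡⟨ cong suc (m+[n∸m]≡n m≤i) ⟩
        suc i             ≡⟨ +-comm 1 i ⟩
        i + 1             ≤⟨ i+1≤M ⟩
        M                 ∎)

  phase₃ : ∀ i → M ≤ i → i ≤ N → c (suc i) + 1 ≡ c i
  phase₃ i M≤i i≤N = subst (λ k → c (suc k) + 1 ≡ c k) (m+[n∸m]≡n M≤i)
    (falling (i ∸ M) (subst (_≤ N) (sym (m+[n∸m]≡n M≤i)) i≤N))

module _ {A : Set} where

  factorAt : ℕ → ℕ → List A → List A
  factorAt n p w = take n (drop p w)

  Occurs : List A → List A → ℕ → Set
  Occurs u w p = p + length u ≤ length w × factorAt (length u) p w ≡ u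

  factorAt-factor : ∀ n p (w : List A) → Factor (factorAt n p w) w
  factorAt-factor n p w = take p w , drop n (drop p w) ,
    sym (trans (cong (take p w ++_) (take++drop≡id n (drop p w))) (take++drop≡id p w))

  length-factorAt : ∀ n p (w : List A) → p + n ≤ length w → length (factorAt n p w) ≡ n
  length-factorAt n zero w n≤ = length-take-≤ n w n≤
  length-factorAt n (suc p) (x ∷ w) (s≤s p+n≤) = length-factorAt n p w p+n≤

  take-factorAt : ∀ n p (w : List A) → take n (factorAt (suc n) p w) ≡ factorAt n p w
  take-factorAt n p w =
    trans (take-take n (suc n) (drop p w)) (cong (λ k → take k (drop p w)) (m≤n⇒m⊓n≡m (n≤1+n n)))

  factorAt-suc : ∀ n p (w : List A) → p < length w →
                 Σ A λ b → factorAt (suc n) p w ≡ b ∷ factorAt n (suc p) w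
  factorAt-suc n zero (b ∷ w) _ = b , refl
  factorAt-suc n (suc p) (x ∷ w) (s≤s p<) = factorAt-suc n p w p<

  shift-left : ∀ n p q (w : List A) {b} → factorAt (suc n) p w ≡ b ∷ factorAt n (suc p) w →
               factorAt (suc n) q w ≡ b ∷ factorAt n (suc q) w →
               factorAt n (suc p) w ≡ factorAt n (suc q) w → factorAt n p w ≡ factorAt n q w
  shift-left n p q w {b} at-p at-q same = begin
    factorAt n p w                       ≡⟨ take-factorAt n p w ⟨
    take n (factorAt (suc n) p w)        ≡⟨ cong (take n) at-p ⟩
    take n (b ∷ factorAt n (suc p) w)    ≡⟨ cong (take n ∘ (b ∷_)) same ⟩
    take n (b ∷ factorAt n (suc q) w)    ≡⟨ cong (take n) at-q ⟨
    take n (factorAt (suc n) q w)        ≡⟨ take-factorAt n q w ⟩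
    factorAt n q w                       ∎
    where open ≡-Reasoning

  factor⇒occurs : ∀ {u w : List A} → Factor u w → Σ ℕ (Occurs u w)
  factor⇒occurs {u} (p , s , refl) =
    length p , bound , trans (cong (take (length u)) (drop-prefix p (u ++ s))) (prefix-take (s , refl))
    where
      drop-prefix : ∀ (p X : List A) → drop (length p) (p ++ X) ≡ X
      drop-prefix [] X = refl
      drop-prefix (x ∷ p) X = drop-prefix p X
      bound : length p + length u ≤ length (p ++ u ++ s)
      bound = subst (length p + length u ≤_) (sym (trans (length-++ p) (cong (length p +_) (length-++ u))))
                    (+-monoʳ-≤ (length p) (m≤m+n (length u) (length s)))

  occurs-init : ∀ {u w : List A} {e p} → Occurs (u ++ [ e ]) w p → Occurs u w p
  occurs-init {u} {w} {e} {p} (bound , at-p) =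
    ≤-trans (+-monoʳ-≤ p (n≤1+n (length u))) (subst (λ k → p + k ≤ length w) (length-snoc u e) bound) ,
    (begin
      factorAt (length u) p w                               ≡⟨ take-factorAt (length u) p w ⟨
      take (length u) (factorAt (suc (length u)) p w)       ≡⟨ cong (λ k → take (length u) (factorAt k p w))
                                                                    (length-snoc u e) ⟨
      take (length u) (factorAt (length (u ++ [ e ])) p w)  ≡⟨ cong (take (length u)) at-p ⟩
      take (length u) (u ++ [ e ])                          ≡⟨ prefix-take ([ e ] , refl) ⟩
      u                                                     ∎)
    where open ≡-Reasoning

  occurs⇒factor : ∀ {u w : List A} {p} → Occurs u w p → Factor u w
  occurs⇒factor {u} {w} {p} (_ , at-p) = subst (λ z → Factor z w) at-p (factorAt-factor (length u) p w)

  occurs-∷ : ∀ {u w : List A} {p} → Occurs u w (suc p) → Σ A λ b → Occurs (b ∷ u) w p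
  occurs-∷ {u} {w} {p} (bound , at-p)
    with b , split ← factorAt-suc (length u) p w (≤-trans (s≤s (m≤m+n p _)) bound) =
    b , subst (_≤ length w) (sym (+-suc p (length u))) bound , trans split (cong (b ∷_) at-p)

  occurs-tail : ∀ {b} {u w : List A} {p} → Occurs (b ∷ u) w p → Occurs u w (suc p)
  occurs-tail {b} {u} {w} {p} (bound , at-p) =
    bound′ , ∷-injectiveʳ (trans (sym (proj₂ (factorAt-suc (length u) p w p<|w|))) at-p)
    where
      bound′ : suc p + length u ≤ length w
      bound′ = subst (_≤ length w) (+-suc p (length u)) bound
      p<|w| : p < length w
      p<|w| = ≤-trans (s≤s (m≤m+n p _)) bound′

indicator : {P : Set} → Dec P → ℕ
indicator (yes _) = 1
indicator (no _) = 0

indicator-yes : {P : Set} (d : Dec P) → P → indicator d ≡ 1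
indicator-yes (yes _) _ = refl
indicator-yes (no ¬p) p = ⊥-elim (¬p p)

indicator-no : {P : Set} (d : Dec P) → ¬ P → indicator d ≡ 0
indicator-no (yes p) ¬p = ⊥-elim (¬p p)
indicator-no (no _) _ = refl

module Words {A : Set} (_≟_ : DecidableEquality A) where

  _≟ₗ_ : DecidableEquality (List A)
  _≟ₗ_ = ≡-dec _≟_

  prefix? : ∀ u w → Dec (Prefix u w)
  prefix? [] w = yes (w , refl)
  prefix? (x ∷ u) [] = no λ ()
  prefix? (x ∷ u) (y ∷ w) with x ≟ y | prefix? u w
  ... | yes refl | yes (s , w≡) = yes (s , cong (x ∷_) w≡)
  ... | yes refl | no ¬pre = no λ (s , w≡) → ¬pre (s , ∷-injectiveʳ w≡)
  ... | no x≢y | _ = no λ (s , w≡) → x≢y (sym (∷-injectiveˡ w≡))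

  factor? : ∀ u w → Dec (Factor u w)
  factor? u [] with u ≟ₗ []
  ... | yes refl = yes ([] , [] , refl)
  ... | no u≢[] = no (u≢[] ∘ factor-[])
  factor? u (a ∷ w) with prefix? u (a ∷ w) | factor? u w
  ... | yes pre | _ = yes (prefix⇒factor pre)
  ... | no _ | yes fac = yes (factor-∷ a fac)
  ... | no ¬pre | no ¬fac = no λ fac → [ ¬fac , ¬pre ]′ (factor-∷⁻ fac)

  suffix? : ∀ u w → Dec (Suffix u w)
  suffix? u [] with u ≟ₗ []
  ... | yes refl = yes ([] , refl)
  ... | no u≢[] = no λ { ([] , w≡) → u≢[] (sym w≡) ; (_ ∷ _ , ()) }
  suffix? u (a ∷ w) with u ≟ₗ (a ∷ w) | suffix? u w
  ... | yes u≡ | _ = yes ([] , sym u≡)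
  ... | no _ | yes (p , w≡) = yes (a ∷ p , cong (a ∷_) w≡)
  ... | no u≢ | no ¬suf = no λ suf → [ ¬suf , u≢ ]′ (suffix-∷⁻ suf)

  rightExt? : ∀ u m w → Dec (RightExt u m w)
  rightExt? u (just c) w = factor? (u ++ [ c ]) w
  rightExt? u nothing w = suffix? u w

  private
    occurrences-∷-≤ : ∀ n a w → n ≤ length (a ∷ w) →
                      factorOccurrences _≟_ n (a ∷ w) ≡ take n (a ∷ w) ∷ factorOccurrences _≟_ n w
    occurrences-∷-≤ n a w n≤ = cong (map (take n)) (filter-accept (λ s → n ≤? length s) n≤)

    occurrences-∷-> : ∀ n a w → ¬ n ≤ length (a ∷ w) → factorOccurrences _≟_ n (a ∷ w) ≡ factorOccurrences _≟_ n w
    occurrences-∷-> n a w n≰ = cong (map (take n)) (filter-reject (λ s → n ≤? length s) n≰)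

    occurrences-⊆-∷ : ∀ n a w → factorOccurrences _≟_ n w ⊆ factorOccurrences _≟_ n (a ∷ w)
    occurrences-⊆-∷ n a w x∈ with n ≤? length (a ∷ w)
    ... | yes n≤ = subst (_ ∈_) (sym (occurrences-∷-≤ n a w n≤)) (there x∈)
    ... | no n≰ = subst (_ ∈_) (sym (occurrences-∷-> n a w n≰)) x∈

  ∈-occurrences⁻ : ∀ n w {x} → x ∈ factorOccurrences _≟_ n w → length x ≡ n × Factor x w
  ∈-occurrences⁻ zero [] (here refl) = refl , factor-refl []
  ∈-occurrences⁻ n (a ∷ w) x∈ with n ≤? length (a ∷ w)
  ... | no n≰ = map₂ (factor-∷ a) (∈-occurrences⁻ n w (subst (_ ∈_) (occurrences-∷-> n a w n≰) x∈))
  ... | yes n≤ with subst (_ ∈_) (occurrences-∷-≤ n a w n≤) x∈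
  ...   | here refl = length-take-≤ n (a ∷ w) n≤ , prefix⇒factor (take-prefix n (a ∷ w))
  ...   | there x∈′ = map₂ (factor-∷ a) (∈-occurrences⁻ n w x∈′)

  ∈-occurrences⁺ : ∀ n w {x} → length x ≡ n → Factor x w → x ∈ factorOccurrences _≟_ n w
  ∈-occurrences⁺ n [] |x|≡n fac with refl ← factor-[] fac | refl ← |x|≡n = here refl
  ∈-occurrences⁺ n (a ∷ w) {x} refl fac with n ≤? length (a ∷ w) | factor-∷⁻ fac
  ... | _ | inj₁ fac′ = occurrences-⊆-∷ n a w (∈-occurrences⁺ n w refl fac′)
  ... | yes n≤ | inj₂ pre = subst (_ ∈_) (sym (occurrences-∷-≤ n a w n≤)) (here (sym (prefix-take pre)))
  ... | no n≰ | inj₂ pre = ⊥-elim (n≰ (factor-length (prefix⇒factor pre)))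

  C : List A → ℕ → ℕ
  C = Defs.C _≟_

  C-characterisation : ∀ w n (S : List (List A)) →
                       (∀ {x} → x ∈ S → length x ≡ n × Factor x w) → (∀ {x} → length x ≡ n → Factor x w → x ∈ S) →
                       C w n ≡ distinct _≟ₗ_ S
  C-characterisation w n S sound complete = distinct-cong _≟ₗ_
    (λ x∈ → let |x|≡n , fac = ∈-occurrences⁻ n w x∈ in complete |x|≡n fac)
    (λ x∈ → let |x|≡n , fac = sound x∈ in ∈-occurrences⁺ n w |x|≡n fac)

  -- Prepending a letter adds at most one factor of each length: the prefix of that length.
  C-∷-old : ∀ n a w → Factor (take n (a ∷ w)) w → C (a ∷ w) n ≡ C w n
  C-∷-old n a w fac with n ≤? length (a ∷ w)
  ... | yes n≤ = trans (cong (distinct _≟ₗ_) (occurrences-∷-≤ n a w n≤))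
                       (distinct-∷-∈ _≟ₗ_ _ (∈-occurrences⁺ n w (length-take-≤ n (a ∷ w) n≤) fac))
  ... | no n≰ = cong (distinct _≟ₗ_) (occurrences-∷-> n a w n≰)

  C-∷-new : ∀ n a w → n ≤ length (a ∷ w) → ¬ Factor (take n (a ∷ w)) w → C (a ∷ w) n ≡ suc (C w n)
  C-∷-new n a w n≤ ¬fac = trans (cong (distinct _≟ₗ_) (occurrences-∷-≤ n a w n≤))
                                (distinct-∷-∉ _≟ₗ_ _ (¬fac ∘ proj₂ ∘ ∈-occurrences⁻ n w))

  C-beyond : ∀ w n → length w < n → C w n ≡ 0
  C-beyond [] (suc n) _ = refl
  C-beyond (a ∷ w) n |w|<n = trans (cong (distinct _≟ₗ_) (occurrences-∷-> n a w (<⇒≱ |w|<n)))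
                                   (C-beyond w n (<-pred (m<n⇒m<1+n |w|<n)))

  C-∷-≤ : ∀ a w n → C (a ∷ w) n ≤ suc (C w n)
  C-∷-≤ a w n with factor? (take n (a ∷ w)) w | n ≤? length (a ∷ w)
  ... | yes fac | _ = ≤-trans (≤-reflexive (C-∷-old n a w fac)) (n≤1+n _)
  ... | no ¬fac | yes n≤ = ≤-reflexive (C-∷-new n a w n≤ ¬fac)
  ... | no _ | no n≰ = ≤-trans (≤-reflexive (C-beyond (a ∷ w) n (≰⇒> n≰))) z≤n

  C-zero : ∀ w → C w 0 ≡ 1
  C-zero [] = refl
  C-zero (a ∷ w) = trans (C-∷-old 0 a w ([] , w , refl)) (C-zero w)

  C-length : ∀ w → C w (length w) ≡ 1
  C-length [] = refl
  C-length (a ∷ w) = trans (C-∷-new (length (a ∷ w)) a w ≤-refl too-long) (cong suc (C-beyond w _ ≤-refl))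
    where
      too-long : ¬ Factor (take (length (a ∷ w)) (a ∷ w)) w
      too-long fac = 1+n≰n (subst (_≤ length w) (length-take-≤ _ (a ∷ w) ≤-refl) (factor-length fac))

  -- The factors of length one are the letters.
  C-one : ∀ w → C w 1 ≡ length (Alph _≟_ w)
  C-one w = trans (C-characterisation w 1 (map [_] w) sound complete)
                  (distinct-map _≟_ _≟ₗ_ [_] (λ { refl → refl }) w)
    where
      sound : ∀ {x} → x ∈ map [_] w → length x ≡ 1 × Factor x w
      sound x∈ with c , c∈ , refl ← ∈-map⁻ [_] x∈ with ys , zs , refl ← ∈-∃++ c∈ = refl , ys , zs , refl
      complete : ∀ {x} → length x ≡ 1 → Factor x w → x ∈ map [_] w
      complete {c ∷ []} _ (p , s , refl) = ∈-map⁺ [_] (∈-++⁺ʳ p (here refl))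

  -- Reversal is a bijection between the factors of w and those of reverse w.
  C-reverse : ∀ w n → C (reverse w) n ≡ C w n
  C-reverse w n = trans (C-characterisation (reverse w) n (map reverse (factorOccurrences _≟_ n w)) sound complete)
                        (distinct-map _≟ₗ_ _≟ₗ_ reverse reverse-injective (factorOccurrences _≟_ n w))
    where
      sound : ∀ {x} → x ∈ map reverse (factorOccurrences _≟_ n w) → length x ≡ n × Factor x (reverse w)
      sound x∈ with y , y∈ , refl ← ∈-map⁻ reverse x∈ with |y|≡n , fac ← ∈-occurrences⁻ n w y∈ =
        trans (length-reverse y) |y|≡n , factor-reverse fac
      complete : ∀ {x} → length x ≡ n → Factor x (reverse w) → x ∈ map reverse (factorOccurrences _≟_ n w)
      complete {x} |x|≡n fac = subst (_∈ _) (reverse-involutive x) (∈-map⁺ reverse (∈-occurrences⁺ n w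
        (trans (length-reverse x) |x|≡n) (subst (Factor (reverse x)) (reverse-involutive w) (factor-reverse fac))))

  alph-mono : ∀ {u w} → Factor u w → length (Alph _≟_ u) ≤ length (Alph _≟_ w)
  alph-mono {u} (p , s , refl) = distinct-mono _≟_ {u} {p ++ u ++ s} (λ z∈ → ∈-++⁺ʳ p (∈-++⁺ˡ z∈))

  alph-nonempty : ∀ {u} → u ≢ [] → 1 ≤ length (Alph _≟_ u)
  alph-nonempty {[]} u≢[] = ⊥-elim (u≢[] refl)
  alph-nonempty {x ∷ u} _ = s≤s z≤n

  -- Counting these positions over all
  -- suffixes measures how C w (suc n) compares with C w n (see `counting').
  Branching : ℕ → List A → Set
  Branching n [] = ⊥
  Branching n (a ∷ w) =
    suc n ≤ length (a ∷ w) × Factor (take n (a ∷ w)) w × ¬ Factor (take (suc n) (a ∷ w)) w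

  branching? : ∀ n w → Dec (Branching n w)
  branching? n [] = no λ ()
  branching? n (a ∷ w)
    with suc n ≤? length (a ∷ w) | factor? (take n (a ∷ w)) w | factor? (take (suc n) (a ∷ w)) w
  ... | yes n< | yes short | no ¬long = yes (n< , short , ¬long)
  ... | no n≮ | _ | _ = no (n≮ ∘ proj₁)
  ... | _ | no ¬short | _ = no (¬short ∘ proj₁ ∘ proj₂)
  ... | _ | _ | yes long = no λ br → proj₂ (proj₂ br) long

  branchCount : ℕ → List A → ℕ
  branchCount n [] = 0
  branchCount n (a ∷ w) = indicator (branching? n (a ∷ w)) + branchCount n w

  branchCount-beyond : ∀ n w → length w ≤ n → branchCount n w ≡ 0
  branchCount-beyond n [] _ = refl
  branchCount-beyond n (a ∷ w) |w|≤n =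
    cong₂ _+_ (indicator-no (branching? n (a ∷ w)) (λ (n< , _) → <⇒≱ n< |w|≤n))
              (branchCount-beyond n w (≤-trans (n≤1+n _) |w|≤n))

  factor-shorter-prefix : ∀ n (s w : List A) → suc n ≤ length s → Factor (take (suc n) s) w → Factor (take n s) w
  factor-shorter-prefix n s w n< fac with e , s≡ ← take-snoc n s n< =
    factor-++ˡ (take n s) [ e ] (subst (λ z → Factor z w) s≡ fac)

  counting : ∀ n w → n ≤ length w → C w (suc n) + 1 ≡ C w n + branchCount n w
  counting zero [] _ = refl
  counting n (a ∷ w) n≤ with m≤n⇒m<n∨m≡n n≤
  ... | inj₂ refl = begin
    C (a ∷ w) (suc (length (a ∷ w))) + 1  ≡⟨ cong (_+ 1) (C-beyond (a ∷ w) _ ≤-refl) ⟩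
    1                                      ≡⟨ cong₂ _+_ (C-length (a ∷ w)) (branchCount-beyond _ (a ∷ w) ≤-refl) ⟨
    C (a ∷ w) (length (a ∷ w)) + branchCount (length (a ∷ w)) (a ∷ w)  ∎
    where open ≡-Reasoning
  ... | inj₁ (s≤s n≤|w|) =
    step (factor? (take (suc n) (a ∷ w)) w) (factor? (take n (a ∷ w)) w) (counting n w n≤|w|)
    where
      step : Dec (Factor (take (suc n) (a ∷ w)) w) → Dec (Factor (take n (a ∷ w)) w) →
             C w (suc n) + 1 ≡ C w n + branchCount n w →
             C (a ∷ w) (suc n) + 1 ≡ C (a ∷ w) n + branchCount n (a ∷ w)
      step (yes long) _ ih = begin
        C (a ∷ w) (suc n) + 1          ≡⟨ cong (_+ 1) (C-∷-old (suc n) a w long) ⟩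
        C w (suc n) + 1                ≡⟨ ih ⟩
        C w n + branchCount n w        ≡⟨ cong₂ _+_ (C-∷-old n a w short) (cong (_+ _) not-branching) ⟨
        C (a ∷ w) n + branchCount n (a ∷ w)  ∎
        where
          open ≡-Reasoning
          short : Factor (take n (a ∷ w)) w
          short = factor-shorter-prefix n (a ∷ w) w (s≤s n≤|w|) long
          not-branching : indicator (branching? n (a ∷ w)) ≡ 0
          not-branching = indicator-no (branching? n (a ∷ w)) (λ (_ , _ , ¬long) → ¬long long)
      step (no ¬long) (yes short) ih = begin
        C (a ∷ w) (suc n) + 1          ≡⟨ cong (_+ 1) (C-∷-new (suc n) a w (s≤s n≤|w|) ¬long) ⟩
        suc (C w (suc n) + 1)          ≡⟨ cong suc ih ⟩
        suc (C w n + branchCount n w)  ≡⟨ +-suc (C w n) _ ⟨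
        C w n + suc (branchCount n w)  ≡⟨ cong₂ _+_ (C-∷-old n a w short) (cong (_+ _) branching) ⟨
        C (a ∷ w) n + branchCount n (a ∷ w)  ∎
        where
          open ≡-Reasoning
          branching : indicator (branching? n (a ∷ w)) ≡ 1
          branching = indicator-yes (branching? n (a ∷ w)) (s≤s n≤|w| , short , ¬long)
      step (no ¬long) (no ¬short) ih = begin
        C (a ∷ w) (suc n) + 1          ≡⟨ cong (_+ 1) (C-∷-new (suc n) a w (s≤s n≤|w|) ¬long) ⟩
        suc (C w (suc n) + 1)          ≡⟨ cong suc ih ⟩
        suc (C w n + branchCount n w)  ≡⟨ cong₂ _+_ (C-∷-new n a w (m≤n⇒m≤1+n n≤|w|) ¬short)
                                                     (cong (_+ _) not-branching) ⟨
        C (a ∷ w) n + branchCount n (a ∷ w)  ∎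
        where
          open ≡-Reasoning
          not-branching : indicator (branching? n (a ∷ w)) ≡ 0
          not-branching = indicator-no (branching? n (a ∷ w)) (λ (_ , short , _) → ¬short short)

  -- Every right special factor
  -- of length n contributes a branching position (the last occurrence of one of
  -- its contexts), and conversely each branching position exhibits one.
  branchCount-∷ : ∀ n a w → branchCount n w ≤ branchCount n (a ∷ w)
  branchCount-∷ n a w = m≤n+m _ _

  branchCount-∷-branching : ∀ n a w → Branching n (a ∷ w) → branchCount n (a ∷ w) ≡ suc (branchCount n w)
  branchCount-∷-branching n a w br = cong (_+ branchCount n w) (indicator-yes (branching? n (a ∷ w)) br)

  lost-context : ∀ {u : List A} {m a w} → RightExt u m (a ∷ w) → ¬ RightExt u m w → ExtAtStart u m (a ∷ w)
  lost-context ext ¬ext with rightExt-∷⁻ ext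
  ... | inj₁ ext′ = ⊥-elim (¬ext ext′)
  ... | inj₂ start = start

  lost-context⇒branching : ∀ {n} {u : List A} {m m′ : Maybe A} {a : A} {w : List A} → length u ≡ n →
                           RightExt u m (a ∷ w) → RightExt u m′ (a ∷ w) → m ≢ m′ → ¬ RightExt u m w →
                           Branching n (a ∷ w)
  lost-context⇒branching {n} {u} {m} {m′} {a} {w} refl ext ext′ m≢m′ ¬ext
    with lost-context ext ¬ext | rightExt-∷⁻ ext′
  ... | start | inj₂ start′ = ⊥-elim (m≢m′ (extAtStart-unique-context start start′))
  ... | start | inj₁ ext″ = branching-at m start (rightExt⇒factor ext″) ¬ext
    where
      branching-at : ∀ m → ExtAtStart u m (a ∷ w) → Factor u w → ¬ RightExt u m w →
                     Branching (length u) (a ∷ w)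
      branching-at nothing refl fac _ = ⊥-elim (1+n≰n (factor-length fac))
      branching-at (just c) pre fac ¬ext =
        subst (_≤ length (a ∷ w)) (length-snoc u c) (factor-length (prefix⇒factor pre)) ,
        subst (λ z → Factor z w) (sym (prefix-take (extAtStart⇒prefix {m = just c} pre))) fac ,
        subst (λ z → ¬ Factor z w) (sym take-long) ¬ext
        where
          take-long : take (suc (length u)) (a ∷ w) ≡ u ++ [ c ]
          take-long = trans (cong (λ k → take k (a ∷ w)) (sym (length-snoc u c))) (prefix-take pre)

  branching-prefix : ∀ {n a w} → Branching n (a ∷ w) →
                     Σ A λ e → length (take n (a ∷ w)) ≡ n × ExtAtStart (take n (a ∷ w)) (just e) (a ∷ w)
                             × Factor (take n (a ∷ w)) w × ¬ RightExt (take n (a ∷ w)) (just e) w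
  branching-prefix {n} {a} {w} (n< , short , ¬long) with e , take≡ ← take-snoc n (a ∷ w) n< =
    e , length-take-≤ n (a ∷ w) (≤-trans (n≤1+n n) n<) ,
    subst (λ z → Prefix z (a ∷ w)) take≡ (take-prefix (suc n) (a ∷ w)) , short ,
    subst (λ z → ¬ Factor z w) take≡ ¬long

  branching⇒rightSpecial : ∀ {n a w} → Branching n (a ∷ w) → RightSpecial n (a ∷ w) (take n (a ∷ w))
  branching⇒rightSpecial {a = a} {w} br with e , |u|≡ , start , short , ¬long ← branching-prefix br
                                          with m , ext ← factor⇒rightExt short =
    |u|≡ , just e , m , (λ { refl → ¬long ext }) , prefix⇒factor start , rightExt-∷ a ext

  rightSpecial-∷⁻ : ∀ {n u a w} → RightSpecial n (a ∷ w) u →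
                    RightSpecial n w u ⊎ (Branching n (a ∷ w) × Σ (Maybe A) λ m → ExtAtStart u m (a ∷ w))
  rightSpecial-∷⁻ {u = u} {w = w} (|u|≡ , m , m′ , m≢m′ , ext , ext′)
    with rightExt? u m w | rightExt? u m′ w
  ... | yes e | yes e′ = inj₁ (|u|≡ , m , m′ , m≢m′ , e , e′)
  ... | no ¬e | _ = inj₂ (lost-context⇒branching |u|≡ ext ext′ m≢m′ ¬e , m , lost-context ext ¬e)
  ... | yes _ | no ¬e′ =
    inj₂ (lost-context⇒branching |u|≡ ext′ ext (m≢m′ ∘ sym) ¬e′ , m′ , lost-context ext′ ¬e′)

  rightSpecial-[] : ∀ {n} {u : List A} → ¬ RightSpecial n [] u
  rightSpecial-[] (_ , _ , _ , m≢m′ , ext , ext′) = rightExt-[] m≢m′ ext ext′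

  rightSpecial⇒branch : ∀ n w {u} → RightSpecial n w u → 1 ≤ branchCount n w
  rightSpecial⇒branch n [] sp = ⊥-elim (rightSpecial-[] sp)
  rightSpecial⇒branch n (a ∷ w) sp with rightSpecial-∷⁻ sp
  ... | inj₁ sp′ = ≤-trans (rightSpecial⇒branch n w sp′) (branchCount-∷ n a w)
  ... | inj₂ (br , _) = ≤-trans (s≤s z≤n) (≤-reflexive (sym (branchCount-∷-branching n a w br)))

  branch⇒rightSpecial : ∀ n w → 1 ≤ branchCount n w → Σ (List A) (RightSpecial n w)
  branch⇒rightSpecial n [] ()
  branch⇒rightSpecial n (a ∷ w) 1≤ with branching? n (a ∷ w)
  ... | yes br = take n (a ∷ w) , branching⇒rightSpecial br
  ... | no _ with u , sp ← branch⇒rightSpecial n w 1≤ = u , rightSpecial-∷ a sp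

  private
    two-branches : ∀ n a w → Branching n (a ∷ w) → 1 ≤ branchCount n w → 2 ≤ branchCount n (a ∷ w)
    two-branches n a w br 1≤ = ≤-trans (s≤s 1≤) (≤-reflexive (sym (branchCount-∷-branching n a w br)))

  twoRightSpecials⇒branch : ∀ n w {u u′} → RightSpecial n w u → RightSpecial n w u′ → u ≢ u′ → 2 ≤ branchCount n w
  twoRightSpecials⇒branch n [] sp _ _ = ⊥-elim (rightSpecial-[] sp)
  twoRightSpecials⇒branch n (a ∷ w) sp sp′ u≢u′ with rightSpecial-∷⁻ sp | rightSpecial-∷⁻ sp′
  ... | inj₁ sp₀ | inj₁ sp₀′ = ≤-trans (twoRightSpecials⇒branch n w sp₀ sp₀′ u≢u′) (branchCount-∷ n a w)
  ... | inj₁ sp₀ | inj₂ (br , _) = two-branches n a w br (rightSpecial⇒branch n w sp₀)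
  ... | inj₂ (br , _) | inj₁ sp₀′ = two-branches n a w br (rightSpecial⇒branch n w sp₀′)
  ... | inj₂ (_ , _ , start) | inj₂ (_ , _ , start′) =
    ⊥-elim (u≢u′ (extAtStart-unique (trans (proj₁ sp) (sym (proj₁ sp′))) start start′))

  both-lost : ∀ {u : List A} {m m′ a w} → RightExt u m (a ∷ w) → ¬ RightExt u m w →
              RightExt u m′ (a ∷ w) → ¬ RightExt u m′ w → m ≡ m′
  both-lost ext ¬ext ext′ ¬ext′ = extAtStart-unique-context (lost-context ext ¬ext) (lost-context ext′ ¬ext′)

  rightTriple-∷⁻ : ∀ {n u a w} → RightTriple n (a ∷ w) u →
                   RightTriple n w u ⊎ (Branching n (a ∷ w) × RightSpecial n w u)
  rightTriple-∷⁻ {u = u} {w = w} (|u|≡ , m₁ , m₂ , m₃ , e₁ , e₂ , e₃ , d₁₂ , d₁₃ , d₂₃)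
    with rightExt? u m₁ w | rightExt? u m₂ w | rightExt? u m₃ w
  ... | yes f₁ | yes f₂ | yes f₃ = inj₁ (|u|≡ , m₁ , m₂ , m₃ , f₁ , f₂ , f₃ , d₁₂ , d₁₃ , d₂₃)
  ... | no ¬f₁ | yes f₂ | yes f₃ =
    inj₂ (lost-context⇒branching |u|≡ e₁ e₂ d₁₂ ¬f₁ , |u|≡ , m₂ , m₃ , d₂₃ , f₂ , f₃)
  ... | yes f₁ | no ¬f₂ | yes f₃ =
    inj₂ (lost-context⇒branching |u|≡ e₂ e₁ (d₁₂ ∘ sym) ¬f₂ , |u|≡ , m₁ , m₃ , d₁₃ , f₁ , f₃)
  ... | yes f₁ | yes f₂ | no ¬f₃ =
    inj₂ (lost-context⇒branching |u|≡ e₃ e₁ (d₁₃ ∘ sym) ¬f₃ , |u|≡ , m₁ , m₂ , d₁₂ , f₁ , f₂)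
  ... | no ¬f₁ | no ¬f₂ | _ = ⊥-elim (d₁₂ (both-lost e₁ ¬f₁ e₂ ¬f₂))
  ... | no ¬f₁ | yes _ | no ¬f₃ = ⊥-elim (d₁₃ (both-lost e₁ ¬f₁ e₃ ¬f₃))
  ... | yes _ | no ¬f₂ | no ¬f₃ = ⊥-elim (d₂₃ (both-lost e₂ ¬f₂ e₃ ¬f₃))

  rightTriple⇒branch : ∀ n w {u} → RightTriple n w u → 2 ≤ branchCount n w
  rightTriple⇒branch n [] (_ , _ , _ , _ , e₁ , e₂ , _ , d₁₂ , _) = ⊥-elim (rightExt-[] d₁₂ e₁ e₂)
  rightTriple⇒branch n (a ∷ w) tr with rightTriple-∷⁻ tr
  ... | inj₁ tr′ = ≤-trans (rightTriple⇒branch n w tr′) (branchCount-∷ n a w)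
  ... | inj₂ (br , sp) = two-branches n a w br (rightSpecial⇒branch n w sp)

  AtMostOneSpecial : ℕ → List A → Set
  AtMostOneSpecial n w =
    (∀ {u u′} → RightSpecial n w u → RightSpecial n w u′ → u ≡ u′) × (∀ {u} → ¬ RightTriple n w u)

  branch≤1⇒atMostOneSpecial : ∀ n w → branchCount n w ≤ 1 → AtMostOneSpecial n w
  branch≤1⇒atMostOneSpecial n w ≤1 = unique , no-triple
    where
      unique : ∀ {u u′} → RightSpecial n w u → RightSpecial n w u′ → u ≡ u′
      unique {u} {u′} sp sp′ with u ≟ₗ u′
      ... | yes u≡u′ = u≡u′
      ... | no u≢u′ = ⊥-elim (<⇒≱ (twoRightSpecials⇒branch n w sp sp′ u≢u′) ≤1)
      no-triple : ∀ {u} → ¬ RightTriple n w u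
      no-triple tr = <⇒≱ (rightTriple⇒branch n w tr) ≤1

  TwoSpecials : ℕ → List A → Set
  TwoSpecials n w = (Σ (List A) λ u → Σ (List A) λ u′ → RightSpecial n w u × RightSpecial n w u′ × u ≢ u′)
                  ⊎ Σ (List A) (RightTriple n w)

  -- the newest branching position either adds a new special factor or a third context
  branch₂⇒specials : ∀ n w → 2 ≤ branchCount n w → TwoSpecials n w
  branch₂⇒specials n [] ()
  branch₂⇒specials n (a ∷ w) 2≤ with branching? n (a ∷ w)
  ... | no _ with branch₂⇒specials n w 2≤
  ...   | inj₁ (u , u′ , sp , sp′ , u≢u′) = inj₁ (u , u′ , rightSpecial-∷ a sp , rightSpecial-∷ a sp′ , u≢u′)
  ...   | inj₂ (u , tr) = inj₂ (u , rightTriple-∷ a tr)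
  branch₂⇒specials n (a ∷ w) (s≤s 1≤) | yes br
    with u′ , sp′@(|u′|≡ , m₃ , m₄ , m₃≢m₄ , e₃ , e₄) ← branch⇒rightSpecial n w 1≤
       | e , |u|≡ , start , _ , ¬ext ← branching-prefix br
       | take n (a ∷ w) ≟ₗ u′
  ... | yes refl =
    inj₂ (u′ , |u|≡ , just e , m₃ , m₄ , prefix⇒factor start , rightExt-∷ a e₃ , rightExt-∷ a e₄ ,
          (λ { refl → ¬ext e₃ }) , (λ { refl → ¬ext e₄ }) , m₃≢m₄)
  ... | no u≢u′ = inj₁ (take n (a ∷ w) , u′ , branching⇒rightSpecial br , rightSpecial-∷ a sp′ , u≢u′)

  atMostOneSpecial⇒branch≤1 : ∀ n w → AtMostOneSpecial n w → branchCount n w ≤ 1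
  atMostOneSpecial⇒branch≤1 n w (unique , no-triple) with 2 ≤? branchCount n w
  ... | no 2≰ = ≤-pred (≰⇒> 2≰)
  ... | yes 2≤ with branch₂⇒specials n w 2≤
  ...   | inj₁ (_ , _ , sp , sp′ , u≢u′) = ⊥-elim (u≢u′ (unique sp sp′))
  ...   | inj₂ (_ , tr) = ⊥-elim (no-triple tr)

  branchCount-≡ : ∀ n w k → n ≤ length w → C w (suc n) + 1 ≡ C w n + k → branchCount n w ≡ k
  branchCount-≡ n w k n≤ step = +-cancelˡ-≡ (C w n) _ _ (trans (sym (counting n w n≤)) step)

  -- Once the complexity drops by one it keeps dropping by one: no branching at
  -- length n means no right special factor of length n, hence none of length n + 1.
  descent-persists : ∀ w n → suc n ≤ length w → C w (suc n) + 1 ≡ C w n → C w (suc (suc n)) + 1 ≡ C w (suc n)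
  descent-persists w n n< descent = begin
    C w (suc (suc n)) + 1                   ≡⟨ counting (suc n) w n< ⟩
    C w (suc n) + branchCount (suc n) w     ≡⟨ cong (C w (suc n) +_) no-branching₁ ⟩
    C w (suc n) + 0                         ≡⟨ +-identityʳ _ ⟩
    C w (suc n)                             ∎
    where
      open ≡-Reasoning
      no-branching₀ : branchCount n w ≡ 0
      no-branching₀ = branchCount-≡ n w 0 (≤-trans (n≤1+n n) n<) (trans descent (sym (+-identityʳ _)))
      no-special₀ : ∀ {u} → ¬ RightSpecial n w u
      no-special₀ sp = <⇒≱ (rightSpecial⇒branch n w sp) (≤-reflexive no-branching₀)
      no-branching₁ : branchCount (suc n) w ≡ 0
      no-branching₁ with 1 ≤? branchCount (suc n) w
      ... | no 1≰ = n<1⇒n≡0 (≰⇒> 1≰)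
      ... | yes 1≤ with branch⇒rightSpecial (suc n) w 1≤
      ...   | [] , () , _
      ...   | _ ∷ _ , sp = ⊥-elim (no-special₀ (rightSpecial-tail sp))

  occurs? : ∀ u w p → Dec (Occurs u w p)
  occurs? u w p with p + length u ≤? length w | factorAt (length u) p w ≟ₗ u
  ... | yes bound | yes at-p = yes (bound , at-p)
  ... | no ¬bound | _ = no (¬bound ∘ proj₁)
  ... | _ | no ¬at-p = no (¬at-p ∘ proj₂)

  -- A factor occurring at positions p < q yields a left special factor of the
  -- same length at some position r ≤ p: walk both occurrences leftwards until
  -- the preceding letters differ or the first occurrence reaches the start.
  repeat⇒leftSpecial : ∀ n w p q → p < q → q + n ≤ length w → factorAt n p w ≡ factorAt n q w →
                       Σ ℕ λ r → r ≤ p × LeftSpecial n w (factorAt n r w)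
  repeat⇒leftSpecial n w zero (suc q) _ q+n≤ same
    with b , at-q ← factorAt-suc n q w (≤-trans (s≤s (m≤m+n q n)) q+n≤) =
    0 , z≤n , length-factorAt n 0 w (≤-trans (m≤n+m n (suc q)) q+n≤) , nothing , just b , (λ ()) ,
    take-prefix n w ,
    subst (λ z → Factor z w) (trans at-q (cong (b ∷_) (sym same))) (factorAt-factor (suc n) q w)
  repeat⇒leftSpecial n w (suc p) (suc q) (s≤s p<q) q+n≤ same
    with b , at-p ← factorAt-suc n p w (<-≤-trans p<q (≤-trans (m≤m+n q n) (<⇒≤ q+n≤)))
       | b′ , at-q ← factorAt-suc n q w (≤-trans (s≤s (m≤m+n q n)) q+n≤)
       | b ≟ b′
  ... | no b≢b′ =
    suc p , ≤-refl , length-factorAt n (suc p) w (≤-trans (+-monoˡ-≤ n (s≤s (<⇒≤ p<q))) q+n≤) ,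
    just b , just b′ , b≢b′ ∘ just-injective ,
    subst (λ z → Factor z w) at-p (factorAt-factor (suc n) p w) ,
    subst (λ z → Factor z w) (trans at-q (cong (b′ ∷_) (sym same))) (factorAt-factor (suc n) q w)
  ... | yes refl with r , r≤p , special ← repeat⇒leftSpecial n w p q p<q (≤-trans (n≤1+n _) q+n≤)
                                 (shift-left n p q w at-p at-q same) =
    r , m≤n⇒m≤1+n r≤p , special

  occurs-elsewhere : ∀ {u w : List A} {c d : A} → c ≢ d → Factor (u ++ [ c ]) w →
                     Factor (u ++ [ d ]) w → ∀ p → Σ ℕ λ j → j ≢ p × Occurs u w j
  occurs-elsewhere {u} {w} {c} {d} c≢d uc ud p
    with j₁ , occ₁ ← factor⇒occurs uc | j₂ , occ₂ ← factor⇒occurs ud | j₁ ℕ.≟ p | j₁ ℕ.≟ j₂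
  ... | no j₁≢p | _ = j₁ , j₁≢p , occurs-init occ₁
  ... | yes _ | yes refl = ⊥-elim (c≢d (∷ʳ-injectiveʳ u u (trans (sym (proj₂ occ₁)) (trans same-length (proj₂ occ₂)))))
    where
      same-length : factorAt (length (u ++ [ c ])) j₁ w ≡ factorAt (length (u ++ [ d ])) j₁ w
      same-length = cong (λ k → factorAt k j₁ w) (trans (length-snoc u c) (sym (length-snoc u d)))
  ... | yes refl | no j₁≢j₂ = j₂ , j₁≢j₂ ∘ sym , occurs-init occ₂

  -- Let v be the only left special factor of its length, without three left
  -- contexts.  Then no letters x ≢ y and c ≢ d make all of x v c, x v d, y v c,
  -- y v d factors: at the first occurrence of v its left context would be the
  -- start of w or a third letter, or a letter b ∈ {x, y} such that b v recurs
  -- later, which produces a left special factor before that first occurrence.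
  no-bispecial-square : ∀ {w v : List A} {x y c d} →
                        (∀ {s} → LeftSpecial (length v) w s → s ≡ v) → ¬ LeftTriple (length v) w v →
                        x ≢ y → c ≢ d → Factor (x ∷ v ++ [ c ]) w → Factor (x ∷ v ++ [ d ]) w →
                        Factor (y ∷ v ++ [ c ]) w → Factor (y ∷ v ++ [ d ]) w → ⊥
  no-bispecial-square {w} {v} {x} {y} {c} {d} only-v no-triple x≢y c≢d xvc xvd yvc yvd =
    at-first-occurrence (least-witness (Occurs v w) (occurs? v w) (proj₂ (factor⇒occurs v-factor)))
    where
      n : ℕ
      n = length v
      xv : Factor (x ∷ v) w
      xv = factor-++ˡ (x ∷ v) [ c ] xvc
      yv : Factor (y ∷ v) w
      yv = factor-++ˡ (y ∷ v) [ c ] yvc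
      v-factor : Factor v w
      v-factor = factor-++ʳ [ x ] v xv

      recurs : ∀ i b → Occurs (b ∷ v) w i → (∀ j → j < suc i → ¬ Occurs v w j) →
               Factor (b ∷ v ++ [ c ]) w → Factor (b ∷ v ++ [ d ]) w → ⊥
      recurs i b (bound-i , at-i) earlier bvc bvd
        with j , j≢i , (bound-j , at-j) ← occurs-elsewhere c≢d bvc bvd i
        with i≤j ← ≮⇒≥ (λ j<i → earlier (suc j) (s≤s j<i) (occurs-tail (bound-j , at-j)))
        with r , r≤i , special ← repeat⇒leftSpecial n w i j (≤∧≢⇒< i≤j (j≢i ∘ sym))
               (≤-trans (+-monoʳ-≤ j (n≤1+n n)) bound-j)
               (trans (sym (take-factorAt n i w))
                      (trans (cong (take n) (trans at-i (sym at-j))) (take-factorAt n j w)))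
        = earlier r (s≤s r≤i) (≤-trans (+-monoˡ-≤ n r≤i) (≤-trans (+-monoʳ-≤ i (n≤1+n n)) bound-i) ,
                               only-v special)

      at-first-occurrence : (Σ ℕ λ i → Occurs v w i × (∀ j → j < i → ¬ Occurs v w j)) → ⊥
      at-first-occurrence (zero , (_ , at-0) , _) =
        no-triple (refl , nothing , just x , just y , subst (λ z → Prefix z w) at-0 (take-prefix n w) ,
                   xv , yv , (λ ()) , (λ ()) , x≢y ∘ just-injective)
      at-first-occurrence (suc i , first , earlier) with b , bv ← occurs-∷ first | b ≟ x | b ≟ y
      ... | yes refl | _ = recurs i b bv earlier xvc xvd
      ... | no _ | yes refl = recurs i b bv earlier yvc yvd
      ... | no b≢x | no b≢y =
        no-triple (refl , just x , just y , just b , xv , yv , occurs⇒factor bv ,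
                   x≢y ∘ just-injective , (b≢x ∘ sym) ∘ just-injective , (b≢y ∘ sym) ∘ just-injective)

  -- If w and its reverse both have at most one right special factor of length n,
  -- each with only two contexts, then so does w at length n + 1.  Two distinct
  -- right special factors x v, y v would share their two contexts, which are
  -- then either the end of w (making x v and y v equal suffixes) or two letters
  -- (a forbidden bispecial square around v).
  atMostOneSpecial-suc : ∀ n w → AtMostOneSpecial n w → AtMostOneSpecial n (reverse w) →
                         AtMostOneSpecial (suc n) w
  atMostOneSpecial-suc n w (unique , no-triple) (unique-rev , no-triple-rev) = unique₁ , no-triple₁
    where
      unique-left : ∀ {s s′} → LeftSpecial n w s → LeftSpecial n w s′ → s ≡ s′
      unique-left ls ls′ = reverse-injective (unique-rev (leftSpecial-reverse ls) (leftSpecial-reverse ls′))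

      no-triple₁ : ∀ {u} → ¬ RightTriple (suc n) w u
      no-triple₁ {[]} (() , _)
      no-triple₁ {_ ∷ _} tr = no-triple (rightTriple-tail tr)

      shared-contexts : ∀ {x y v m₁ m₂} → length v ≡ n → x ≢ y → m₁ ≢ m₂ →
                        RightExt (x ∷ v) m₁ w → RightExt (x ∷ v) m₂ w →
                        RightExt (y ∷ v) m₁ w → RightExt (y ∷ v) m₂ w → ⊥
      shared-contexts {m₁ = nothing} _ x≢y _ xv-end _ yv-end _ =
        x≢y (∷-injectiveˡ (suffix-unique refl xv-end yv-end))
      shared-contexts {m₁ = just c} {nothing} _ x≢y _ _ xv-end _ yv-end =
        x≢y (∷-injectiveˡ (suffix-unique refl xv-end yv-end))
      shared-contexts {x} {y} {v} {just c} {just d} refl x≢y c≢d xvc xvd yvc yvd =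
        no-bispecial-square only-v (no-triple-rev ∘ leftTriple-reverse) x≢y (c≢d ∘ cong just) xvc xvd yvc yvd
        where
          v-special : LeftSpecial n w v
          v-special = refl , just x , just y , x≢y ∘ just-injective ,
                      factor-++ˡ (x ∷ v) [ c ] xvc , factor-++ˡ (y ∷ v) [ c ] yvc
          only-v : ∀ {s} → LeftSpecial n w s → s ≡ v
          only-v ls = unique-left ls v-special

      sharing-suffix : ∀ {x y v} → x ≢ y → RightSpecial (suc n) w (x ∷ v) → RightSpecial (suc n) w (y ∷ v) → ⊥
      sharing-suffix {v = v} x≢y sp@(|xv|≡ , m₁ , m₂ , m₁≢m₂ , e₁ , e₂) (_ , m₃ , m₄ , m₃≢m₄ , e₃ , e₄)
        with contexts-of-v m₃ (rightExt-tail e₃) | contexts-of-v m₄ (rightExt-tail e₄)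
        where
          -- v has no third context, so its contexts are m₁ and m₂
          contexts-of-v : ∀ m → RightExt v m w → m ≡ m₁ ⊎ m ≡ m₂
          contexts-of-v m ext with Maybe.≡-dec _≟_ m m₁ | Maybe.≡-dec _≟_ m m₂
          ... | yes m≡m₁ | _ = inj₁ m≡m₁
          ... | no _ | yes m≡m₂ = inj₂ m≡m₂
          ... | no m≢m₁ | no m≢m₂ = ⊥-elim (no-triple (suc-injective |xv|≡ , m₁ , m₂ , m ,
            rightExt-tail e₁ , rightExt-tail e₂ , ext , m₁≢m₂ , m≢m₁ ∘ sym , m≢m₂ ∘ sym))
      ... | inj₁ refl | inj₁ refl = m₃≢m₄ refl
      ... | inj₂ refl | inj₂ refl = m₃≢m₄ refl
      ... | inj₁ refl | inj₂ refl = shared-contexts (suc-injective |xv|≡) x≢y m₁≢m₂ e₁ e₂ e₃ e₄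
      ... | inj₂ refl | inj₁ refl = shared-contexts (suc-injective |xv|≡) x≢y m₁≢m₂ e₁ e₂ e₄ e₃

      unique₁ : ∀ {u u′} → RightSpecial (suc n) w u → RightSpecial (suc n) w u′ → u ≡ u′
      unique₁ {[]} (() , _) _
      unique₁ {_ ∷ _} {[]} _ (() , _)
      unique₁ {x ∷ v} {y ∷ v′} sp sp′ with unique (rightSpecial-tail sp) (rightSpecial-tail sp′)
      ... | refl with x ≟ y
      ...   | yes refl = refl
      ...   | no x≢y = ⊥-elim (sharing-suffix x≢y sp sp′)

  -- After a plateau the complexity does not increase: a plateau means exactly one
  -- branching position, for w and for its reverse alike.
  plateau-persists : ∀ w n → suc n ≤ length w → C w (suc n) ≡ C w n → C w (suc (suc n)) ≤ C w (suc n)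
  plateau-persists w n n< plateau = +-cancelʳ-≤ 1 _ _ (begin
    C w (suc (suc n)) + 1                  ≡⟨ counting (suc n) w n< ⟩
    C w (suc n) + branchCount (suc n) w    ≤⟨ +-monoʳ-≤ (C w (suc n)) (atMostOneSpecial⇒branch≤1 (suc n) w simple₁) ⟩
    C w (suc n) + 1                        ∎)
    where
      open ≤-Reasoning
      n≤ : n ≤ length w
      n≤ = ≤-trans (n≤1+n n) n<
      simple : ∀ v → branchCount n v ≡ 1 → AtMostOneSpecial n v
      simple v one = branch≤1⇒atMostOneSpecial n v (≤-reflexive one)
      one-branch : branchCount n w ≡ 1
      one-branch = branchCount-≡ n w 1 n≤ (cong (_+ 1) plateau)
      one-branch-rev : branchCount n (reverse w) ≡ 1
      one-branch-rev = branchCount-≡ n (reverse w) 1 (subst (n ≤_) (sym (length-reverse w)) n≤)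
        (cong (_+ 1) (trans (C-reverse w (suc n)) (trans plateau (sym (C-reverse w n)))))
      simple₁ : AtMostOneSpecial (suc n) w
      simple₁ = atMostOneSpecial-suc n w (simple w one-branch) (simple (reverse w) one-branch-rev)

  GTShape : List A → Set
  GTShape w = Σ ℕ λ m → Σ ℕ λ M →
      1 ≤ m × m ≤ M
    × C w 0 ≡ 1
    × (∀ i → 1 ≤ i → i ≤ m → C w i ≡ length (Alph _≟_ w) + i ∸ 1)
    × (∀ i → m ≤ i → i + 1 ≤ M → C w (suc i) ≡ C w i)
    × (∀ i → M ≤ i → i ≤ length w → C w (suc i) + 1 ≡ C w i)

  -- From length 1 on, the complexity grows by at most one per step.  For a
  -- nonempty word this is all that is needed to have the GT profile.
  SlowGrowth : List A → Set
  SlowGrowth w = ∀ n → 1 ≤ n → C w (suc n) ≤ suc (C w n)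

  gtShape⇒slowGrowth : ∀ w → GTShape w → SlowGrowth w
  gtShape⇒slowGrowth w (m , M , _ , _ , _ , rising , level , falling) n 1≤n
    with n ℕ.<? m | n ℕ.<? M | n ≤? length w
  ... | yes n<m | _ | _ = begin
    C w (suc n)                        ≡⟨ rising (suc n) (s≤s z≤n) n<m ⟩
    length (Alph _≟_ w) + suc n ∸ 1    ≡⟨ cong (_∸ 1) (+-suc (length (Alph _≟_ w)) n) ⟩
    length (Alph _≟_ w) + n            ≤⟨ m≤n+m∸n (length (Alph _≟_ w) + n) 1 ⟩
    suc (length (Alph _≟_ w) + n ∸ 1)  ≡⟨ cong suc (rising n 1≤n (<⇒≤ n<m)) ⟨
    suc (C w n)                        ∎
    where open ≤-Reasoning
  ... | no n≮m | yes n<M | _ =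
    ≤-trans (≤-reflexive (level n (≮⇒≥ n≮m) (subst (_≤ M) (+-comm 1 n) n<M))) (n≤1+n _)
  ... | no _ | no n≮M | yes n≤ =
    ≤-trans (m≤m+n _ 1) (≤-trans (≤-reflexive (falling n (≮⇒≥ n≮M) n≤)) (n≤1+n _))
  ... | no _ | no _ | no n≰ = ≤-trans (≤-reflexive (C-beyond w (suc n) (m<n⇒m<1+n (≰⇒> n≰)))) z≤n

  -- The step bound at n passes from a ∷ w to w: a new long prefix accounts for
  -- at most one new factor at each length.
  growth-tail : ∀ a w n → C (a ∷ w) (suc n) ≤ suc (C (a ∷ w) n) → C w (suc n) ≤ suc (C w n)
  growth-tail a w n bound with suc n ≤? length w | factor? (take (suc n) (a ∷ w)) w
  ... | no n≮ | _ = ≤-trans (≤-reflexive (C-beyond w (suc n) (≰⇒> n≮))) z≤n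
  ... | yes n< | yes long = subst₂ (λ x y → x ≤ suc y) (C-∷-old (suc n) a w long)
      (C-∷-old n a w (factor-shorter-prefix n (a ∷ w) w (m≤n⇒m≤1+n n<) long)) bound
  ... | yes n< | no ¬long = ≤-pred (begin
    suc (C w (suc n))   ≡⟨ C-∷-new (suc n) a w (m≤n⇒m≤1+n n<) ¬long ⟨
    C (a ∷ w) (suc n)   ≤⟨ bound ⟩
    suc (C (a ∷ w) n)   ≤⟨ s≤s (C-∷-≤ a w n) ⟩
    suc (suc (C w n))   ∎)
    where open ≤-Reasoning

  slowGrowth-suffix : ∀ p x → SlowGrowth (p ++ x) → SlowGrowth x
  slowGrowth-suffix [] x slow = slow
  slowGrowth-suffix (a ∷ p) x slow = slowGrowth-suffix p x (λ n 1≤n → growth-tail a (p ++ x) n (slow n 1≤n))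

  slowGrowth-reverse : ∀ w → SlowGrowth w → SlowGrowth (reverse w)
  slowGrowth-reverse w slow n 1≤n =
    subst₂ (λ x y → x ≤ suc y) (sym (C-reverse w (suc n))) (sym (C-reverse w n)) (slow n 1≤n)

  -- Factors are suffixes of prefixes, and prefixes are reversed suffixes.
  slowGrowth-factor : ∀ {u w} → Factor u w → SlowGrowth w → SlowGrowth u
  slowGrowth-factor {u} (p , s , refl) slow =
    subst SlowGrowth (reverse-involutive u)
      (slowGrowth-reverse (reverse u) (slowGrowth-suffix (reverse s) (reverse u)
        (subst SlowGrowth (reverse-++ u s) (slowGrowth-reverse (u ++ s) (slowGrowth-suffix p (u ++ s) slow)))))

  slowGrowth⇒gtShape : ∀ u → u ≢ [] → SlowGrowth u → GTShape u
  slowGrowth⇒gtShape [] u≢[] _ = ⊥-elim (u≢[] refl)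
  slowGrowth⇒gtShape u@(_ ∷ _) _ slow =
    m , M , s≤s z≤n , m≤M , C-zero u ,
    (λ i 1≤i i≤m → trans (phase₁ i 1≤i i≤m) (cong (λ k → k + i ∸ 1) (C-one u))) , phase₂ , phase₃
    where
      fall≤1 : ∀ n → n ≤ length u → C u n ≤ C u (suc n) + 1
      fall≤1 n n≤ = ≤-trans (m≤m+n (C u n) _) (≤-reflexive (sym (counting n u n≤)))
      falls-at-end : C u (suc (length u)) + 1 ≤ C u (length u)
      falls-at-end = ≤-reflexive (trans (cong (_+ 1) (C-beyond u _ ≤-refl)) (sym (C-length u)))
      open Shape (C u) (length u) (s≤s z≤n) slow fall≤1 (descent-persists u) (plateau-persists u) falls-at-end

-- A factor u
-- of w has at most as many letters as w.  If u has one letter it is a GT-word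
-- by definition; otherwise neither has w, so w has the GT profile, hence slow
-- growth; slow growth passes to the factor u, and gives u the GT profile.
proposition3p6 : {A : Set} (_≟_ : DecidableEquality A) (w u : List A) →
    IsGT _≟_ w → u ≢ [] → Factor u w → IsGT _≟_ u
proposition3p6 _≟_ w u w-GT u≢[] u-factor with length (Alph _≟_ u) ℕ.≟ 1
... | yes one-letter = inj₁ (u≢[] , one-letter)
... | no ¬one-letter =
  inj₂ (two-letters , slowGrowth⇒gtShape u u≢[] (slowGrowth-factor u-factor (w-slow w-GT)))
  where
    open Words _≟_
    two-letters : 2 ≤ length (Alph _≟_ u)
    two-letters = ≤∧≢⇒< (alph-nonempty u≢[]) (¬one-letter ∘ sym)
    w-slow : IsGT _≟_ w → SlowGrowth w
    w-slow (inj₁ (_ , w-one-letter)) =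
      ⊥-elim (<⇒≱ two-letters (≤-trans (alph-mono u-factor) (≤-reflexive w-one-letter)))
    w-slow (inj₂ (_ , w-shape)) = gtShape⇒slowGrowth w w-shape
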